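{- Assume the abc conjecture holds. Let $a_1<a_2<a_3<\cdots$ be the increasing enumeration of all $3$-powerful positive integers. Then $\liminf_{n\to\infty}|a_{n+1}-a_n|=\infty$.
   Context: For a positive integer $n$, $\mathrm{rad}(n)$ denotes the product of the distinct primes dividing $n$. The abc conjecture states: for every real $\epsilon>0$ there are only finitely many triples $(a,b,c)$ of coprime positive integers with $a+b=c$ and $c>(\mathrm{rad}(abc))^{1+\epsilon}$. A positive integer $x$ is $3$-powerful if $p^3\mid x$ for every prime $p$ with $p\mid x$. -}

module Defs where

open import Data.Nat using (ℕ; zero; suc; _+_; _*_; _∸_; _^_; _≤_; _<_)
open import Data.Nat.Divisibility using (_∣_; _∣?_)
open import Data.Nat.Primality using (Prime; prime?)
open import Data.Nat.Coprimality using (Coprime)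
open import Data.Product using (Σ; _×_; ∃)
open import Relation.Nullary using (yes; no)
open import Relation.Binary.PropositionalEquality using (_≡_)

radAux : ℕ → ℕ → ℕ
radAux n zero = 1
radAux n (suc k) with prime? (suc k) | suc k ∣? n
... | yes _ | yes _ = suc k * radAux n k
... | _     | _     = radAux n k

-- rad n = product of the distinct primes dividing n (primes dividing n ≥ 1 are ≤ n)
rad : ℕ → ℕ
rad n = radAux n n

ThreePowerful : ℕ → Set
ThreePowerful x = (0 < x) × (∀ p → Prime p → p ∣ x → p ^ 3 ∣ x)

-- abc conjecture, with ε = e/d a positive rational (e, d ≥ 1):
-- c > rad(abc)^(1+e/d)  ⇔  c^d > rad(abc)^(d+e).
-- "only finitely many triples" ⇔ c is bounded (since a, b < c).
ABC : Set
ABC = ∀ (e d : ℕ) → 0 < e → 0 < d →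
      ∃ λ (B : ℕ) → ∀ (a b c : ℕ) → 0 < a → 0 < b → a + b ≡ c → Coprime a b →
        rad (a * b * c) ^ (d + e) < c ^ d → c ≤ B

IsIncreasingEnumeration3Powerful : (ℕ → ℕ) → Set
IsIncreasingEnumeration3Powerful a =
  (∀ n → a n < a (suc n)) ×
  (∀ n → ThreePowerful (a n)) ×
  (∀ x → ThreePowerful x → ∃ λ n → a n ≡ x)

{-# OPTIONS --safe #-}
module Submission where

-- Let x < y be 3-powerful with gap k = y − x and put g = gcd(x, k), so that x = gA, k = gB and
-- y = gC with A + B = C and A, B coprime.  Since rad(n)³ ≤ n for 3-powerful n and x ≤ y ≤ kC,
--   rad(ABC)³ ≤ rad(x)³ rad(k)³ rad(y)³ ≤ x k³ y ≤ k⁵ C².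
-- When C > k²⁰ this yields rad(ABC)⁴ < C³, an exceptional abc triple for ε = 1/3, so abc bounds C
-- and therefore y ≤ kC in terms of k alone.  Hence a gap below M can only occur below a fixed
-- bound, whereas the n-th 3-powerful number is at least n.

open import Defs
open import Data.Nat.Base
  using (ℕ; zero; suc; _+_; _*_; _∸_; _^_; _/_; _≤_; _<_; z≤n; s≤s; z<s; NonZero; >-nonZero; ≢-nonZero; nonTrivial⇒≢1)
open import Data.Nat.Properties
open import Data.Nat.DivMod using (m*[n/m]≡n)
open import Data.Nat.Divisibility
open import Data.Nat.Primality using (Prime; prime?; euclidsLemma; prime⇒irreducible; prime⇒nonTrivial)
open import Data.Nat.Coprimality using (Coprime; coprime-divisor; 1-coprimeTo; coprime-/gcd)
import Data.Nat.Coprimality as Coprime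
open import Data.Nat.GCD using (gcd; gcd[m,n]∣m; gcd[m,n]∣n; gcd[m,n]≢0; gcd[m,n]≤n; m/gcd[m,n]≢0; n/gcd[m,n]≢0)
open import Data.Nat.Tactic.RingSolver using (solve-∀)
open import Algebra.Properties.CommutativeSemigroup *-commutativeSemigroup using (x∙yz≈y∙xz; interchange)
open import Data.Product using (∃; _×_; _,_; proj₁)
open import Data.Sum using (_⊎_; inj₁; inj₂; [_,_]′)
open import Relation.Nullary using (yes; no; contradiction)
open import Relation.Binary.PropositionalEquality using (_≡_; refl; sym; trans; cong; cong₂; subst; subst₂)

Powerful : ℕ → ℕ → Set
Powerful j n = ∀ p → Prime p → p ∣ n → p ^ j ∣ n

^-distribʳ-* : ∀ m n j → (m * n) ^ j ≡ m ^ j * n ^ j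
^-distribʳ-* m n zero = refl
^-distribʳ-* m n (suc j) =
  trans (cong (m * n *_) (^-distribʳ-* m n j)) (interchange m n (m ^ j) (n ^ j))

positive-divisor : ∀ {m n} → 0 < n → m ∣ n → 0 < m
positive-divisor {zero} 0<n 0∣n = contradiction (0∣⇒≡0 0∣n) (m<n⇒n≢0 0<n)
positive-divisor {suc _} _ _ = z<s

coprime-* : ∀ {m n o} → Coprime m n → Coprime m o → Coprime m (n * o)
coprime-* m⊥n m⊥o (d∣m , d∣no) =
  m⊥o (d∣m , coprime-divisor (λ (e∣d , e∣n) → m⊥n (∣-trans e∣d d∣m , e∣n)) d∣no)

coprime-^ : ∀ {m n} j → Coprime m n → Coprime m (n ^ j)
coprime-^ {m} zero _ = Coprime.sym (1-coprimeTo m)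
coprime-^ (suc j) m⊥n = coprime-* m⊥n (coprime-^ j m⊥n)

coprime⇒*-∣ : ∀ {u v n} → Coprime u v → u ∣ n → v ∣ n → u * v ∣ n
coprime⇒*-∣ {u} {v} u⊥v (divides q n≡q*u) v∣n =
  subst (u * v ∣_) (trans (*-comm u q) (sym n≡q*u))
    (*-monoʳ-∣ u (coprime-divisor (Coprime.sym u⊥v) (subst (v ∣_) (trans n≡q*u (*-comm q u)) v∣n)))

radAux-positive : ∀ n K → 0 < radAux n K
radAux-positive n zero = z<s
radAux-positive n (suc K) with prime? (suc K) | suc K ∣? n
... | yes _ | yes _ = *-mono-≤ {1} {suc K} z<s (radAux-positive n K)
... | yes _ | no _ = radAux-positive n K
... | no _  | _    = radAux-positive n K

radAux-∣-suc : ∀ n K → radAux n K ∣ radAux n (suc K)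
radAux-∣-suc n K with prime? (suc K) | suc K ∣? n
... | yes _ | yes _ = n∣m*n (suc K)
... | yes _ | no _ = ∣-refl
... | no _  | _    = ∣-refl

radAux-suc : ∀ n K → Prime (suc K) → suc K ∣ n → radAux n (suc K) ≡ suc K * radAux n K
radAux-suc n K p p∣n with prime? (suc K) | suc K ∣? n
... | yes _ | yes _  = refl
... | yes _ | no p∤n = contradiction p∣n p∤n
... | no ¬p | _      = contradiction p ¬p

radAux-suc-cases : ∀ n K → (Prime (suc K) × suc K ∣ n) ⊎ (radAux n (suc K) ≡ radAux n K)
radAux-suc-cases n K with prime? (suc K) | suc K ∣? n
... | yes p | yes p∣n = inj₁ (p , p∣n)
... | yes _ | no _    = inj₂ refl
... | no _  | _       = inj₂ refl

radAux-mono : ∀ m n K → (∀ p → Prime p → p ∣ m → p ∣ n) → radAux m K ∣ radAux n K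
radAux-mono m n zero _ = ∣-refl
radAux-mono m n (suc K) m⊆n with radAux-suc-cases m K
... | inj₁ (p , p∣m) = begin
  radAux m (suc K)     ≡⟨ radAux-suc m K p p∣m ⟩
  suc K * radAux m K   ∣⟨ *-monoʳ-∣ (suc K) (radAux-mono m n K m⊆n) ⟩
  suc K * radAux n K   ≡⟨ radAux-suc n K p (m⊆n _ p p∣m) ⟨
  radAux n (suc K)     ∎
  where open ∣-Reasoning
... | inj₂ unchanged = begin
  radAux m (suc K)     ≡⟨ unchanged ⟩
  radAux m K           ∣⟨ radAux-mono m n K m⊆n ⟩
  radAux n K           ∣⟨ radAux-∣-suc n K ⟩
  radAux n (suc K)     ∎
  where open ∣-Reasoning

radAux-*-∣ : ∀ m n K → radAux (m * n) K ∣ radAux m K * radAux n K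
radAux-*-∣ m n zero = ∣-refl
radAux-*-∣ m n (suc K) with radAux-suc-cases (m * n) K
... | inj₂ unchanged = begin
  radAux (m * n) (suc K)              ≡⟨ unchanged ⟩
  radAux (m * n) K                    ∣⟨ radAux-*-∣ m n K ⟩
  radAux m K * radAux n K             ∣⟨ *-pres-∣ (radAux-∣-suc m K) (radAux-∣-suc n K) ⟩
  radAux m (suc K) * radAux n (suc K) ∎
  where open ∣-Reasoning
... | inj₁ (p , p∣mn) with euclidsLemma m n p p∣mn
...   | inj₁ p∣m = begin
  radAux (m * n) (suc K)              ≡⟨ radAux-suc (m * n) K p p∣mn ⟩
  suc K * radAux (m * n) K            ∣⟨ *-monoʳ-∣ (suc K) (radAux-*-∣ m n K) ⟩
  suc K * (radAux m K * radAux n K)   ≡⟨ *-assoc (suc K) (radAux m K) (radAux n K) ⟨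
  suc K * radAux m K * radAux n K     ≡⟨ cong (_* radAux n K) (radAux-suc m K p p∣m) ⟨
  radAux m (suc K) * radAux n K       ∣⟨ *-monoʳ-∣ (radAux m (suc K)) (radAux-∣-suc n K) ⟩
  radAux m (suc K) * radAux n (suc K) ∎
  where open ∣-Reasoning
...   | inj₂ p∣n = begin
  radAux (m * n) (suc K)              ≡⟨ radAux-suc (m * n) K p p∣mn ⟩
  suc K * radAux (m * n) K            ∣⟨ *-monoʳ-∣ (suc K) (radAux-*-∣ m n K) ⟩
  suc K * (radAux m K * radAux n K)   ≡⟨ x∙yz≈y∙xz (suc K) (radAux m K) (radAux n K) ⟩
  radAux m K * (suc K * radAux n K)   ≡⟨ cong (radAux m K *_) (radAux-suc n K p p∣n) ⟨
  radAux m K * radAux n (suc K)       ∣⟨ *-monoˡ-∣ (radAux n (suc K)) (radAux-∣-suc m K) ⟩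
  radAux m (suc K) * radAux n (suc K) ∎
  where open ∣-Reasoning

prime∣radAux⇒≤ : ∀ n K p → Prime p → p ∣ radAux n K → p ≤ K
prime∣radAux⇒≤ n zero p p-prime p∣1 =
  contradiction (∣1⇒≡1 p∣1) (nonTrivial⇒≢1 {{prime⇒nonTrivial p-prime}})
prime∣radAux⇒≤ n (suc K) p p-prime p∣R with prime? (suc K) | suc K ∣? n
... | yes _ | yes _ =
  [ ∣⇒≤ , (λ p∣R′ → m≤n⇒m≤1+n (prime∣radAux⇒≤ n K p p-prime p∣R′)) ]′ (euclidsLemma (suc K) _ p-prime p∣R)
... | yes _ | no _ = m≤n⇒m≤1+n (prime∣radAux⇒≤ n K p p-prime p∣R)
... | no _  | _    = m≤n⇒m≤1+n (prime∣radAux⇒≤ n K p p-prime p∣R)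

coprime-radAux : ∀ n K p → Prime p → K < p → Coprime p (radAux n K)
coprime-radAux n K p p-prime K<p (d∣p , d∣R) with prime⇒irreducible p-prime d∣p
... | inj₁ d≡1 = d≡1
... | inj₂ refl = contradiction (prime∣radAux⇒≤ n K _ p-prime d∣R) (<⇒≱ K<p)

radAux-^-∣ : ∀ n j K → Powerful j n → radAux n K ^ j ∣ n
radAux-^-∣ n j zero _ = subst (_∣ n) (sym (^-zeroˡ j)) (1∣ n)
radAux-^-∣ n j (suc K) powerful with prime? (suc K) | suc K ∣? n
... | yes p | yes p∣n =
  subst (_∣ n) (sym (^-distribʳ-* (suc K) (radAux n K) j))
    (coprime⇒*-∣ (Coprime.sym (coprime-^ j (Coprime.sym (coprime-^ j (coprime-radAux n K (suc K) p ≤-refl)))))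
                 (powerful _ p p∣n) (radAux-^-∣ n j K powerful))
... | yes _ | no _ = radAux-^-∣ n j K powerful
... | no _  | _    = radAux-^-∣ n j K powerful

radAux-stable : ∀ m → 0 < m → ∀ K → m ≤ K → radAux m K ≡ rad m
radAux-stable m 0<m zero m≤0 = contradiction m≤0 (<⇒≱ 0<m)
radAux-stable m 0<m (suc K) m≤1+K with m≤n⇒m<n∨m≡n m≤1+K
... | inj₂ refl = refl
... | inj₁ (s≤s m≤K) = trans step (radAux-stable m 0<m K m≤K)
  where
  step : radAux m (suc K) ≡ radAux m K
  step with prime? (suc K) | suc K ∣? m
  ... | yes _ | yes 1+K∣m = contradiction (∣⇒≤ {{>-nonZero 0<m}} 1+K∣m) (<⇒≱ (s≤s m≤K))
  ... | yes _ | no _ = refl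
  ... | no _  | _    = refl

rad-mono-∣ : ∀ {m n} → 0 < n → m ∣ n → rad m ∣ rad n
rad-mono-∣ {m} {n} 0<n m∣n =
  subst (_∣ rad n) (radAux-stable m (positive-divisor 0<n m∣n) n (∣⇒≤ {{>-nonZero 0<n}} m∣n))
    (radAux-mono m n n (λ _ _ p∣m → ∣-trans p∣m m∣n))

rad-*-∣ : ∀ {m n} → 0 < m → 0 < n → rad (m * n) ∣ rad m * rad n
rad-*-∣ {m} {n} 0<m 0<n =
  subst₂ (λ u v → rad (m * n) ∣ u * v)
    (radAux-stable m 0<m (m * n) (m≤m*n m n {{>-nonZero 0<n}}))
    (radAux-stable n 0<n (m * n) (m≤n*m n m {{>-nonZero 0<m}}))
    (radAux-*-∣ m n (m * n))

rad-^-≤ : ∀ {n} j → 0 < n → Powerful j n → rad n ^ j ≤ n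
rad-^-≤ {n} j 0<n powerful = ∣⇒≤ {{>-nonZero 0<n}} (radAux-^-∣ n j n powerful)

rad≤n : ∀ {n} → 0 < n → rad n ≤ n
rad≤n {n} 0<n = subst (_≤ n) (*-identityʳ (rad n))
  (rad-^-≤ 1 0<n (λ p _ p∣n → subst (_∣ n) (sym (*-identityʳ p)) p∣n))

rad[a*b*c]^3≤x*k^3*y : ∀ {a b c x k y} → ThreePowerful x → 0 < k → ThreePowerful y →
                        a ∣ x → b ∣ k → c ∣ y → rad (a * b * c) ^ 3 ≤ x * k ^ 3 * y
rad[a*b*c]^3≤x*k^3*y {a} {b} {c} {x} {k} {y} (0<x , x-powerful) 0<k (0<y , y-powerful) a∣x b∣k c∣y =
  begin
  rad (a * b * c) ^ 3                    ≤⟨ ^-monoˡ-≤ 3 rad[abc]≤ ⟩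
  (rad x * rad k * rad y) ^ 3            ≡⟨ ^-distribʳ-* (rad x * rad k) (rad y) 3 ⟩
  (rad x * rad k) ^ 3 * rad y ^ 3        ≡⟨ cong (_* rad y ^ 3) (^-distribʳ-* (rad x) (rad k) 3) ⟩
  rad x ^ 3 * rad k ^ 3 * rad y ^ 3      ≤⟨ *-mono-≤ (*-mono-≤ (rad-^-≤ 3 0<x x-powerful) (^-monoˡ-≤ 3 (rad≤n 0<k)))
                                                     (rad-^-≤ 3 0<y y-powerful) ⟩
  x * k ^ 3 * y                          ∎
  where
  open ≤-Reasoning
  0<xk : 0 < x * k
  0<xk = *-mono-≤ 0<x 0<k
  0<rad[xky] : 0 < rad x * rad k * rad y
  0<rad[xky] = *-mono-≤ (*-mono-≤ (radAux-positive x x) (radAux-positive k k)) (radAux-positive y y)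
  rad[abc]≤ : rad (a * b * c) ≤ rad x * rad k * rad y
  rad[abc]≤ = ∣⇒≤ {{>-nonZero 0<rad[xky]}}
    (∣-trans (rad-mono-∣ (*-mono-≤ 0<xk 0<y) (*-pres-∣ (*-pres-∣ a∣x b∣k) c∣y))
      (∣-trans (rad-*-∣ 0<xk 0<y) (*-monoˡ-∣ (rad y) (rad-*-∣ 0<x 0<k))))

x*k^3*y≤k^5*C^2 : ∀ {x y} k C → x ≤ y → y ≤ k * C → x * k ^ 3 * y ≤ k ^ 5 * C ^ 2
x*k^3*y≤k^5*C^2 {x} {y} k C x≤y y≤kC = begin
  x * k ^ 3 * y               ≤⟨ *-mono-≤ (*-monoˡ-≤ (k ^ 3) (≤-trans x≤y y≤kC)) y≤kC ⟩
  (k * C) * k ^ 3 * (k * C)   ≡⟨ regroup k C ⟩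
  k ^ 5 * C ^ 2               ∎
  where
  open ≤-Reasoning
  -- Powers are unfolded because the ring solver does not normalise _^_ with literal exponents.
  regroup : ∀ k C → (k * C) * (k * (k * (k * 1))) * (k * C) ≡ (k * (k * (k * (k * (k * 1))))) * (C * (C * 1))
  regroup = solve-∀

r^3≤k^5*C^2⇒r^4<C^3 : ∀ r k C → r ^ 3 ≤ k ^ 5 * C ^ 2 → k ^ 20 < C → r ^ 4 < C ^ 3
r^3≤k^5*C^2⇒r^4<C^3 r k C r^3≤ k^20<C = ≰⇒> λ C^3≤r^4 →
  <⇒≱ r^12<C^9 (subst₂ _≤_ (^-*-assoc C 3 3) (^-*-assoc r 4 3) (^-monoˡ-≤ 3 C^3≤r^4))
  where
  open ≤-Reasoning
  r^12<C^9 : r ^ 12 < C ^ 9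
  r^12<C^9 = begin-strict
    r ^ 12                  ≡⟨ ^-*-assoc r 3 4 ⟨
    (r ^ 3) ^ 4             ≤⟨ ^-monoˡ-≤ 4 r^3≤ ⟩
    (k ^ 5 * C ^ 2) ^ 4     ≡⟨ ^-distribʳ-* (k ^ 5) (C ^ 2) 4 ⟩
    (k ^ 5) ^ 4 * (C ^ 2) ^ 4 ≡⟨ cong₂ _*_ (^-*-assoc k 5 4) (^-*-assoc C 2 4) ⟩
    k ^ 20 * C ^ 8          <⟨ *-monoˡ-< (C ^ 8) {{m^n≢0 C 8 {{>-nonZero (≤-trans z<s k^20<C)}}}} k^20<C ⟩
    C ^ 9                   ∎

gap-bound : ABC → ∃ λ B → ∀ x y → ThreePowerful x → ThreePowerful y → x < y →
            y ≤ (B + (y ∸ x) ^ 20) * (y ∸ x)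
gap-bound abc with abc 1 3 z<s z<s
... | B , abc-bound = B , bound
  where
  bound : ∀ x y → ThreePowerful x → ThreePowerful y → x < y → y ≤ (B + (y ∸ x) ^ 20) * (y ∸ x)
  bound x y x-3powerful y-3powerful x<y = begin
    y                ≤⟨ y≤k*C ⟩
    k * C            ≤⟨ *-monoʳ-≤ k C≤B+k^20 ⟩
    k * (B + k ^ 20) ≡⟨ *-comm k _ ⟩
    (B + k ^ 20) * k ∎
    where
    open ≤-Reasoning
    k = y ∸ x
    0<x = proj₁ x-3powerful
    0<k = m<n⇒0<n∸m x<y
    instance
      x≢0 : NonZero x
      x≢0 = >-nonZero 0<x
      k≢0 : NonZero k
      k≢0 = >-nonZero 0<k
    g = gcd x k
    instance
      g≢0 : NonZero g
      g≢0 = ≢-nonZero (gcd[m,n]≢0 x k (inj₂ (m<n⇒n≢0 0<k)))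
    A = x / g
    Bk = k / g
    C = A + Bk
    x≡g*A : x ≡ g * A
    x≡g*A = sym (m*[n/m]≡n (gcd[m,n]∣m x k))
    k≡g*Bk : k ≡ g * Bk
    k≡g*Bk = sym (m*[n/m]≡n (gcd[m,n]∣n x k))
    y≡g*C : y ≡ g * C
    y≡g*C = trans (sym (m+[n∸m]≡n (<⇒≤ x<y)))
              (trans (cong₂ _+_ x≡g*A k≡g*Bk) (sym (*-distribˡ-+ g A Bk)))
    y≤k*C : y ≤ k * C
    y≤k*C = subst (_≤ k * C) (sym y≡g*C) (*-monoˡ-≤ C (gcd[m,n]≤n x k))
    C≤B+k^20 : C ≤ B + k ^ 20
    C≤B+k^20 with k ^ 20 <? C
    ... | no k^20≮C = ≤-trans (≮⇒≥ k^20≮C) (m≤n+m _ B)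
    ... | yes k^20<C = ≤-trans (abc-bound A Bk C 0<A 0<Bk refl (coprime-/gcd x k) abc-hit) (m≤m+n B _)
      where
      0<A : 0 < A
      0<A = n≢0⇒n>0 (m/gcd[m,n]≢0 x k)
      0<Bk : 0 < Bk
      0<Bk = n≢0⇒n>0 (n/gcd[m,n]≢0 x k)
      abc-hit : rad (A * Bk * C) ^ 4 < C ^ 3
      abc-hit = r^3≤k^5*C^2⇒r^4<C^3 (rad (A * Bk * C)) k C
        (≤-trans (rad[a*b*c]^3≤x*k^3*y x-3powerful 0<k y-3powerful
                   (divides g x≡g*A) (divides g k≡g*Bk) (divides g y≡g*C))
                 (x*k^3*y≤k^5*C^2 k C (<⇒≤ x<y) y≤k*C))
        k^20<C

n≤a[n] : ∀ (a : ℕ → ℕ) → (∀ n → a n < a (suc n)) → ∀ n → n ≤ a n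
n≤a[n] a increasing zero = z≤n
n≤a[n] a increasing (suc n) = ≤-trans (s≤s (n≤a[n] a increasing n)) (increasing n)

mainTheorem6 : ABC → (a : ℕ → ℕ) → IsIncreasingEnumeration3Powerful a →
    ∀ (M : ℕ) → ∃ λ (N : ℕ) → ∀ n → N ≤ n → M ≤ a (suc n) ∸ a n
mainTheorem6 abc a (increasing , 3powerful , _) M with gap-bound abc
... | B , bound = N , M≤gap
  where
  N = (B + M ^ 20) * M
  M≤gap : ∀ n → N ≤ n → M ≤ a (suc n) ∸ a n
  M≤gap n N≤n with M ≤? a (suc n) ∸ a n
  ... | yes M≤gap = M≤gap
  ... | no M≰gap = contradiction a[1+n]<a[1+n] (<-irrefl refl)
    where
    open ≤-Reasoning
    gap = a (suc n) ∸ a n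
    gap≤M = <⇒≤ (≰⇒> M≰gap)
    a[1+n]<a[1+n] : a (suc n) < a (suc n)
    a[1+n]<a[1+n] = begin-strict
      a (suc n)            ≤⟨ bound (a n) (a (suc n)) (3powerful n) (3powerful (suc n)) (increasing n) ⟩
      (B + gap ^ 20) * gap ≤⟨ *-mono-≤ (+-monoʳ-≤ B (^-monoˡ-≤ 20 gap≤M)) gap≤M ⟩
      N                    ≤⟨ N≤n ⟩
      n                    <⟨ n<1+n n ⟩
      suc n                ≤⟨ n≤a[n] a increasing (suc n) ⟩
      a (suc n)            ∎
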